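{- Let $\mu$ be the Thue–Morse morphism on $\{0,1\}^*$, defined by $\mu(0) = 01$, $\mu(1) = 10$. Let $s$ be a positive integer and let $z$ be a subword (factor) of $\mu^s(01)$ with $|z| > 2^s$. Then $z$ does not have period $2^s$.
   Context: A word $z = z_1 z_2 \cdots z_m$ has period $p$ (with $1\le p \le m$) if $z_i = z_{i+p}$ for all $1 \le i \le m-p$. -}

module Defs where

open import Data.Bool using (Bool; true; false; not)
open import Data.List using (List; []; _∷_; _++_; length; concatMap)
open import Data.Maybe using (Maybe; just; nothing)
open import Data.Nat using (ℕ; zero; suc; _+_; _≤_; _<_)
open import Data.Product using (Σ; _×_; ∃)
open import Relation.Binary.PropositionalEquality using (_≡_)

-- Binary alphabet {0,1}: false = 0, true = 1.
Word : Set
Word = List Bool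

μ₁ : Bool → Word
μ₁ b = b ∷ not b ∷ []

μ : Word → Word
μ = concatMap μ₁

μ^ : ℕ → Word → Word
μ^ zero    w = w
μ^ (suc s) w = μ (μ^ s w)

w01 : Word
w01 = false ∷ true ∷ []

Factor : Word → Word → Set
Factor z w = ∃ λ u → ∃ λ v → u ++ z ++ v ≡ w

at : Word → ℕ → Maybe Bool
at []      _       = nothing
at (x ∷ _) zero    = just x
at (_ ∷ z) (suc i) = at z i

-- z = z_1…z_m has period p (1 ≤ p ≤ m) if z_i = z_{i+p} for all 1 ≤ i ≤ m - p
-- (here 0-indexed: for all i with i + p < m).
HasPeriod : Word → ℕ → Set
HasPeriod z p = (1 ≤ p) × (p ≤ length z) ×
  (∀ i → i + p < length z → at z i ≡ at z (i + p))

-- μ^s(01) = μ^s(0) μ^s(1) is a word X followed by its complement, with |X| = 2^s.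
-- A factor z of length > 2^s starts at an offset i < 2^s, so its letters z₀ and
-- z_{2^s} are X_i and the complement of X_i: they differ, and 2^s is not a period.
-- The argument also works for s = 0.
module Submission where

open import Defs
open import Data.Bool using (false; not)
open import Data.Bool.Properties using (not-¬)
open import Data.List using ([]; _∷_; _++_; length; map; concat; concatMap)
open import Data.List.Properties using (length-++; length-map; map-++; concat-++; concatMap-cong; concatMap-map; map-concatMap)
open import Data.Maybe using (just)
import Data.Maybe as Maybe
open import Data.Maybe.Properties using (just-injective)
open import Data.Nat using (ℕ; zero; suc; _+_; _*_; _^_; _<_; _≤_; s≤s; z≤n)
open import Data.Nat.Properties using (+-comm; +-identityʳ; *-suc; *-assoc; *-identityʳ; m≤m+n; +-monoʳ-≤; +-monoʳ-<; module ≤-Reasoning; +-cancelʳ-<; ≤-trans)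
open import Data.Product using (∃; _,_)
open import Function using (_∘_)
open import Relation.Binary.PropositionalEquality using (_≡_; refl; sym; trans; cong; subst; module ≡-Reasoning)
open import Relation.Nullary using (¬_)

at-++ˡ : ∀ (xs ys : Word) i → i < length xs → at (xs ++ ys) i ≡ at xs i
at-++ˡ (x ∷ xs) ys zero    _         = refl
at-++ˡ (x ∷ xs) ys (suc i) (s≤s i<n) = at-++ˡ xs ys i i<n

at-++ʳ : ∀ (xs ys : Word) i → at (xs ++ ys) (length xs + i) ≡ at ys i
at-++ʳ []       ys i = refl
at-++ʳ (x ∷ xs) ys i = at-++ʳ xs ys i

at-map : ∀ f (xs : Word) i → at (map f xs) i ≡ Maybe.map f (at xs i)
at-map f []       i       = refl
at-map f (x ∷ xs) zero    = refl
at-map f (x ∷ xs) (suc i) = at-map f xs i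

at-< : ∀ (xs : Word) i → i < length xs → ∃ λ b → at xs i ≡ just b
at-< (x ∷ xs) zero    _         = x , refl
at-< (x ∷ xs) (suc i) (s≤s i<n) = at-< xs i i<n

at-factor : ∀ u z v {w : Word} → u ++ z ++ v ≡ w →
            ∀ i → i < length z → at w (length u + i) ≡ at z i
at-factor u z v refl i i<∣z∣ = trans (at-++ʳ u (z ++ v) i) (at-++ˡ z v i i<∣z∣)

length-factor : ∀ u z v {w : Word} → u ++ z ++ v ≡ w → length u + length z ≤ length w
length-factor u z v refl = begin
  length u + length z               ≤⟨ +-monoʳ-≤ (length u) (m≤m+n (length z) (length v)) ⟩
  length u + (length z + length v)  ≡⟨ cong (length u +_) (sym (length-++ z)) ⟩
  length u + length (z ++ v)        ≡⟨ sym (length-++ u) ⟩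
  length (u ++ z ++ v)              ∎
  where open ≤-Reasoning

μ-++ : ∀ xs ys → μ (xs ++ ys) ≡ μ xs ++ μ ys
μ-++ xs ys = trans (cong concat (map-++ μ₁ xs ys)) (sym (concat-++ (map μ₁ xs) (map μ₁ ys)))

μ-map-not : ∀ xs → μ (map not xs) ≡ map not (μ xs)
μ-map-not xs = begin
  μ (map not xs)               ≡⟨ concatMap-map μ₁ not xs ⟩
  concatMap (μ₁ ∘ not) xs      ≡⟨ concatMap-cong (λ _ → refl) xs ⟩
  concatMap (map not ∘ μ₁) xs  ≡⟨ sym (map-concatMap not μ₁ xs) ⟩
  map not (μ xs)               ∎
  where open ≡-Reasoning

length-μ : ∀ xs → length (μ xs) ≡ 2 * length xs
length-μ []       = refl
length-μ (x ∷ xs) = trans (cong (2 +_) (length-μ xs)) (sym (*-suc 2 (length xs)))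

μ^-++ : ∀ s xs ys → μ^ s (xs ++ ys) ≡ μ^ s xs ++ μ^ s ys
μ^-++ zero    xs ys = refl
μ^-++ (suc s) xs ys = trans (cong μ (μ^-++ s xs ys)) (μ-++ (μ^ s xs) (μ^ s ys))

μ^-map-not : ∀ s xs → μ^ s (map not xs) ≡ map not (μ^ s xs)
μ^-map-not zero    xs = refl
μ^-map-not (suc s) xs = trans (cong μ (μ^-map-not s xs)) (μ-map-not (μ^ s xs))

length-μ^ : ∀ s xs → length (μ^ s xs) ≡ 2 ^ s * length xs
length-μ^ zero    xs = sym (+-identityʳ (length xs))
length-μ^ (suc s) xs = begin
  length (μ (μ^ s xs))      ≡⟨ length-μ (μ^ s xs) ⟩
  2 * length (μ^ s xs)      ≡⟨ cong (2 *_) (length-μ^ s xs) ⟩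
  2 * (2 ^ s * length xs)   ≡⟨ sym (*-assoc 2 (2 ^ s) (length xs)) ⟩
  2 ^ suc s * length xs     ∎
  where open ≡-Reasoning

μ^-w01 : ∀ s → μ^ s w01 ≡ μ^ s (false ∷ []) ++ map not (μ^ s (false ∷ []))
μ^-w01 s = trans (μ^-++ s (false ∷ []) (not false ∷ []))
                 (cong (μ^ s (false ∷ []) ++_) (μ^-map-not s (false ∷ [])))

at-complement-square : ∀ X i → i < length X →
  at (X ++ map not X) (i + length X) ≡ Maybe.map not (at (X ++ map not X) i)
at-complement-square X i i<∣X∣ = begin
  at (X ++ map not X) (i + length X)      ≡⟨ cong (at (X ++ map not X)) (+-comm i (length X)) ⟩
  at (X ++ map not X) (length X + i)      ≡⟨ at-++ʳ X (map not X) i ⟩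
  at (map not X) i                        ≡⟨ at-map not X i ⟩
  Maybe.map not (at X i)                  ≡⟨ cong (Maybe.map not) (sym (at-++ˡ X (map not X) i i<∣X∣)) ⟩
  Maybe.map not (at (X ++ map not X) i)   ∎
  where open ≡-Reasoning

complement-square-factor-offset : ∀ X u z v → u ++ z ++ v ≡ X ++ map not X →
  length X < length z → length u < length X
complement-square-factor-offset X u z v eq ∣X∣<∣z∣ = +-cancelʳ-< n i n (begin-strict
  i + n                        <⟨ +-monoʳ-< i ∣X∣<∣z∣ ⟩
  i + length z                 ≤⟨ length-factor u z v eq ⟩
  length (X ++ map not X)      ≡⟨ length-++ X ⟩
  n + length (map not X)       ≡⟨ cong (n +_) (length-map not X) ⟩
  n + n                        ∎)
  where
  open ≤-Reasoning
  n i : ℕ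
  n = length X
  i = length u

factor-complement-square-not-periodic : ∀ X z → Factor z (X ++ map not X) →
  length X < length z → ¬ HasPeriod z (length X)
factor-complement-square-not-periodic X z (u , v , eq) ∣X∣<∣z∣ (_ , _ , periodic)
  with b , z₀≡b ← at-< z 0 (≤-trans (s≤s z≤n) ∣X∣<∣z∣)
  = not-¬ refl (just-injective (begin
      just b                 ≡⟨ sym z₀≡b ⟩
      at z 0                 ≡⟨ periodic 0 ∣X∣<∣z∣ ⟩
      at z (length X)        ≡⟨ shift ⟩
      Maybe.map not (at z 0) ≡⟨ cong (Maybe.map not) z₀≡b ⟩
      just (not b)           ∎))
  where
  open ≡-Reasoning
  w : Word
  w = X ++ map not X
  n i : ℕ
  n = length X
  i = length u

  i<n : i < n
  i<n = complement-square-factor-offset X u z v eq ∣X∣<∣z∣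

  0<∣z∣ : 0 < length z
  0<∣z∣ = ≤-trans (s≤s z≤n) ∣X∣<∣z∣

  shift : at z n ≡ Maybe.map not (at z 0)
  shift = begin
    at z n                              ≡⟨ sym (at-factor u z v eq n ∣X∣<∣z∣) ⟩
    at w (i + n)                        ≡⟨ at-complement-square X i i<n ⟩
    Maybe.map not (at w i)              ≡⟨ cong (Maybe.map not ∘ at w) (sym (+-identityʳ i)) ⟩
    Maybe.map not (at w (i + 0))        ≡⟨ cong (Maybe.map not) (at-factor u z v eq 0 0<∣z∣) ⟩
    Maybe.map not (at z 0)              ∎

lemma1 : (s : ℕ) → 1 ≤ s → (z : Word) → Factor z (μ^ s w01) →
         2 ^ s < length z → ¬ HasPeriod z (2 ^ s)
lemma1 s _ z factor 2^s<∣z∣ =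
  subst (¬_ ∘ HasPeriod z) ∣X∣≡2^s
    (factor-complement-square-not-periodic X z (subst (Factor z) (μ^-w01 s) factor)
      (subst (_< length z) (sym ∣X∣≡2^s) 2^s<∣z∣))
  where
  X : Word
  X = μ^ s (false ∷ [])
  ∣X∣≡2^s : length X ≡ 2 ^ s
  ∣X∣≡2^s = trans (length-μ^ s (false ∷ [])) (*-identityʳ (2 ^ s))
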